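{- Consider the following algorithm for an instance of unweighted stochastic probing with deadlines. Let $\mathcal{L}=\{U\subseteq V: |U\cap\{e:d_e\le t\}|\le t\ \forall t\ge1\}$. Start with $Q=S=B=\emptyset$ and $t=1$. For each $e\in V$ in non-increasing order of $p_e$: if $Q\cup\{e\}\in\mathcal{I}_{out}\cap\mathcal{L}$ and $S\cup\{e\}\in\mathcal{I}_{in}$, then set $Q\gets Q\cup\{e\}$, and (a) if $t\le d_e$, probe $e$, set $t\gets t+1$, and add $e$ to $S$ if $e$ is active; (b) otherwise set $B\gets B\cup\{e\}$ and add $e$ to $S$ with probability $p_e$ (independently). Then for every outcome $\pi$ of the randomness, with $Q_\pi$ and $B_\pi$ the final sets $Q$ and $B$, $$\sum_{e\in Q_\pi}p_e\ \le\ 2\sum_{e\in Q_\pi\setminus B_\pi}p_e .$$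
   Context: Unweighted stochastic probing with deadlines: $V$ is a finite universe; each $e\in V$ has a probability $p_e\in[0,1]$, is active independently with probability $p_e$, and has a positive integer deadline $d_e$. $\mathcal{I}_{in},\mathcal{I}_{out}\subseteq 2^V$ are downward-closed families. Each probe takes one unit of time and an element can only be probed at a time $t\le d_e$. An outcome $\pi$ is a realization of all random choices (activity of elements and the coins used for elements in $B$).
   Formalization: The probabilities $p_e$ take values in the rationals between 0 and 1. -}

module Defs where

open import Data.Nat using (ℕ; zero; suc; _≤_; _<_; _≤ᵇ_)
open import Data.Bool using (Bool; true; false; if_then_else_)
open import Data.Fin using (Fin) renaming (zero to fzero; suc to fsuc)
open import Data.Fin.Subset using (Subset; inside; outside; _∪_; _∩_; _⊆_; ⁅_⁆; ∣_∣; _∈_)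
open import Data.Vec using (Vec; tabulate; []; _∷_)
open import Data.List using (List; []; _∷_)
open import Data.Rational using (ℚ; 0ℚ; _+_)
open import Data.Product using (_×_; _,_)
open import Relation.Nullary using (¬_)
open import Relation.Binary.PropositionalEquality using (_≡_)

sumOver : ∀ {n} → (Fin n → ℚ) → Subset n → ℚ
sumOver {zero}  p []             = 0ℚ
sumOver {suc n} p (inside  ∷ U) = p fzero + sumOver (λ i → p (fsuc i)) U
sumOver {suc n} p (outside ∷ U) = sumOver (λ i → p (fsuc i)) U

DownwardClosed : ∀ {n} → (Subset n → Set) → Set
DownwardClosed {n} I = ∀ (A B : Subset n) → A ⊆ B → I B → I A

dueBy : ∀ {n} → (Fin n → ℕ) → ℕ → Subset n
dueBy d t = tabulate (λ e → if d e ≤ᵇ t then inside else outside)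

InL : ∀ {n} → (Fin n → ℕ) → Subset n → Set
InL d U = ∀ (t : ℕ) → 1 ≤ t → ∣ U ∩ dueBy d t ∣ ≤ t

record State (n : ℕ) : Set where
  constructor ⟨_,_,_,_⟩
  field
    Q S B : Subset n
    t     : ℕ

Accept : ∀ {n} → (Subset n → Set) → (Subset n → Set) → (Fin n → ℕ)
       → Subset n → Subset n → Fin n → Set
Accept Iin Iout d Q S e =
  Iout (Q ∪ ⁅ e ⁆) × InL d (Q ∪ ⁅ e ⁆) × Iin (S ∪ ⁅ e ⁆)

-- One step of the algorithm processing element e, under outcome π.
-- π e is the single random bit associated with e: its activity if e is
-- probed, or the outcome of the p_e-coin if e is put into B (each element
-- is processed exactly once, so one bit per element suffices).
data Step {n : ℕ} (Iin Iout : Subset n → Set) (d : Fin n → ℕ) (π : Fin n → Bool)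
     : State n → Fin n → State n → Set where
  reject       : ∀ {Q S B t e} → ¬ Accept Iin Iout d Q S e
               → Step Iin Iout d π ⟨ Q , S , B , t ⟩ e ⟨ Q , S , B , t ⟩
  probe-active : ∀ {Q S B t e} → Accept Iin Iout d Q S e → t ≤ d e → π e ≡ true
               → Step Iin Iout d π ⟨ Q , S , B , t ⟩ e ⟨ Q ∪ ⁅ e ⁆ , S ∪ ⁅ e ⁆ , B , suc t ⟩
  probe-inactive : ∀ {Q S B t e} → Accept Iin Iout d Q S e → t ≤ d e → π e ≡ false
               → Step Iin Iout d π ⟨ Q , S , B , t ⟩ e ⟨ Q ∪ ⁅ e ⁆ , S , B , suc t ⟩
  late-heads   : ∀ {Q S B t e} → Accept Iin Iout d Q S e → d e < t → π e ≡ true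
               → Step Iin Iout d π ⟨ Q , S , B , t ⟩ e ⟨ Q ∪ ⁅ e ⁆ , S ∪ ⁅ e ⁆ , B ∪ ⁅ e ⁆ , t ⟩
  late-tails   : ∀ {Q S B t e} → Accept Iin Iout d Q S e → d e < t → π e ≡ false
               → Step Iin Iout d π ⟨ Q , S , B , t ⟩ e ⟨ Q ∪ ⁅ e ⁆ , S , B ∪ ⁅ e ⁆ , t ⟩

data Run {n : ℕ} (Iin Iout : Subset n → Set) (d : Fin n → ℕ) (π : Fin n → Bool)
     : State n → List (Fin n) → State n → Set where
  done : ∀ {s} → Run Iin Iout d π s [] s
  step : ∀ {s s′ s″ e es} → Step Iin Iout d π s e s′ → Run Iin Iout d π s′ es s″
       → Run Iin Iout d π s (e ∷ es) s″

initial : ∀ {n} → State n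
initial = ⟨ Data.Fin.Subset.⊥ , Data.Fin.Subset.⊥ , Data.Fin.Subset.⊥ , 1 ⟩

-- Every element put into B is late, so it can be charged to an element probed
-- earlier, which by the processing order has at least its probability.
-- Concretely, if t − 1 = |B| + slack elements have been probed and c is the
-- probability of the element processed last, then 2 p(B) + slack · c ≤ p(Q)
-- throughout.  A probe raises p(Q) by p_e = c and the slack by one.  A late
-- element e has d_e < t, as do all elements of B, so Q ∪ {e} ∈ L at time
-- t − 1 forces |B ∪ {e}| ≤ t − 1, i.e. slack ≥ 1, and one unit of slack pays
-- for e.  At the end p(B) ≤ p(Q ∖ B).
module Submission where

open import Defs
open import Data.Bool using (Bool; true; T; if_then_else_)
open import Data.Empty using (⊥-elim)
open import Data.Fin using (Fin) renaming (zero to fzero; suc to fsuc)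
open import Data.Fin.Subset using (Subset; _─_; inside; outside; _∪_; _∩_; _⊆_; ⁅_⁆; ∣_∣; _∈_; _∉_; ⊥)
open import Data.Fin.Subset.Properties
  using (∉⊥; ⊆-refl; ∣⊥∣≡0; p⊆p∪q; x∈p∪q⁻; x∈p∪q⁺; x∈p∩q⁺; x∈⁅y⁆⇒x≡y; p⊆q⇒∣p∣≤∣q∣;
         ∪-identityʳ; drop-∷-⊆; drop-not-there)
open import Data.List using (List; allFin; _∷_)
open import Data.List.Relation.Binary.Permutation.Propositional using (_↭_; ↭-sym; ↭⇒↭ₛ)
open import Data.List.Relation.Binary.Permutation.Setoid.Properties using (Unique-resp-↭)
open import Data.List.Relation.Unary.All as All using (All; _∷_)
open import Data.List.Relation.Unary.AllPairs using (AllPairs; _∷_)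
open import Data.List.Relation.Unary.Unique.Propositional.Properties using (allFin⁺)
open import Data.Nat using (ℕ; zero; suc; _≤_; _<_) renaming (_+_ to _ℕ+_)
import Data.Nat.Properties as ℕ
open import Data.Product using (∃-syntax; _×_; _,_)
open import Data.Rational using (ℚ; 0ℚ; 1ℚ; _+_; _*_; -_; +-0-rawMonoid) renaming (_≤_ to _≤ℚ_)
open import Algebra.Definitions.RawMonoid +-0-rawMonoid using () renaming (_×_ to _·_)
import Data.Rational.Properties as ℚ
open import Data.Rational.Solver using (module +-*-Solver)
open import Data.Sum using (inj₁; inj₂)
open import Data.Vec using ([]; _∷_; here; there)
open import Data.Vec.Properties using (lookup⇒[]=; lookup∘tabulate)
open import Function using (_∘′_)
open import Relation.Binary.PropositionalEquality
open +-*-Solver using (solve; _:=_; _:+_; _:-_; _:*_; con)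

+-cancelʳ-≤ : ∀ r {p q} → p + r ≤ℚ q + r → p ≤ℚ q
+-cancelʳ-≤ r {p} {q} le = subst₂ _≤ℚ_ (+-r-r p) (+-r-r q) (ℚ.+-monoˡ-≤ (- r) le)
  where
  +-r-r : ∀ x → x + r + - r ≡ x
  +-r-r x = solve 2 (λ x r → x :+ r :- r := x) refl x r

·-monoʳ-≤ : ∀ j {c c′} → c′ ≤ℚ c → j · c′ ≤ℚ j · c
·-monoʳ-≤ zero    _  = ℚ.≤-refl
·-monoʳ-≤ (suc j) le = ℚ.+-mono-≤ le (·-monoʳ-≤ j le)

·-nonNeg : ∀ j {c} → 0ℚ ≤ℚ c → 0ℚ ≤ℚ j · c
·-nonNeg zero    _  = ℚ.≤-refl
·-nonNeg (suc j) 0≤c = ℚ.+-mono-≤ 0≤c (·-nonNeg j 0≤c)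

sumOver-⊥ : ∀ {n} (p : Fin n → ℚ) → sumOver p ⊥ ≡ 0ℚ
sumOver-⊥ {zero}  p = refl
sumOver-⊥ {suc n} p = sumOver-⊥ (λ i → p (fsuc i))

sumOver-∪⁅⁆ : ∀ {n} (p : Fin n → ℚ) {X : Subset n} {x} → x ∉ X
            → sumOver p (X ∪ ⁅ x ⁆) ≡ p x + sumOver p X
sumOver-∪⁅⁆ p {inside  ∷ X} {fzero}  x∉X = ⊥-elim (x∉X here)
sumOver-∪⁅⁆ p {outside ∷ X} {fzero}  x∉X = cong (p fzero +_) (cong (sumOver _) (∪-identityʳ X))
sumOver-∪⁅⁆ p {inside  ∷ X} {fsuc x} x∉X = begin
  p fzero + sumOver p′ (X ∪ ⁅ x ⁆) ≡⟨ cong (p fzero +_) (sumOver-∪⁅⁆ p′ (drop-not-there x∉X)) ⟩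
  p fzero + (p′ x + sumOver p′ X)  ≡⟨ solve 3 (λ a b c → a :+ (b :+ c) := b :+ (a :+ c)) refl (p fzero) (p′ x) (sumOver p′ X) ⟩
  p′ x + (p fzero + sumOver p′ X)  ∎
  where
  open ≡-Reasoning
  p′ = λ i → p (fsuc i)
sumOver-∪⁅⁆ p {outside ∷ X} {fsuc x} x∉X = sumOver-∪⁅⁆ (λ i → p (fsuc i)) (drop-not-there x∉X)

sumOver-─ : ∀ {n} (p : Fin n → ℚ) {Q B : Subset n} → B ⊆ Q
          → sumOver p Q ≡ sumOver p (Q ─ B) + sumOver p B
sumOver-─ p {[]}          {[]}          _   = refl
sumOver-─ p {outside ∷ Q} {inside  ∷ B} B⊆Q with B⊆Q here
... | ()
sumOver-─ p {outside ∷ Q} {outside ∷ B} B⊆Q = sumOver-─ (λ i → p (fsuc i)) (drop-∷-⊆ B⊆Q)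
sumOver-─ p {inside  ∷ Q} {inside  ∷ B} B⊆Q = begin
  p fzero + sumOver p′ Q                          ≡⟨ cong (p fzero +_) (sumOver-─ p′ (drop-∷-⊆ B⊆Q)) ⟩
  p fzero + (sumOver p′ (Q ─ B) + sumOver p′ B)   ≡⟨ solve 3 (λ a b c → a :+ (b :+ c) := b :+ (a :+ c)) refl (p fzero) (sumOver p′ (Q ─ B)) (sumOver p′ B) ⟩
  sumOver p′ (Q ─ B) + (p fzero + sumOver p′ B)   ∎
  where
  open ≡-Reasoning
  p′ = λ i → p (fsuc i)
sumOver-─ p {inside  ∷ Q} {outside ∷ B} B⊆Q = begin
  p fzero + sumOver p′ Q                          ≡⟨ cong (p fzero +_) (sumOver-─ p′ (drop-∷-⊆ B⊆Q)) ⟩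
  p fzero + (sumOver p′ (Q ─ B) + sumOver p′ B)   ≡⟨ ℚ.+-assoc (p fzero) _ _ ⟨
  p fzero + sumOver p′ (Q ─ B) + sumOver p′ B     ∎
  where
  open ≡-Reasoning
  p′ = λ i → p (fsuc i)

∣p∪⁅x⁆∣≡1+∣p∣ : ∀ {n} {X : Subset n} {x} → x ∉ X → ∣ X ∪ ⁅ x ⁆ ∣ ≡ suc ∣ X ∣
∣p∪⁅x⁆∣≡1+∣p∣ {X = inside  ∷ X} {fzero}  x∉X = ⊥-elim (x∉X here)
∣p∪⁅x⁆∣≡1+∣p∣ {X = outside ∷ X} {fzero}  x∉X = cong (suc ∘′ ∣_∣) (∪-identityʳ X)
∣p∪⁅x⁆∣≡1+∣p∣ {X = inside  ∷ X} {fsuc x} x∉X = cong suc (∣p∪⁅x⁆∣≡1+∣p∣ (drop-not-there x∉X))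
∣p∪⁅x⁆∣≡1+∣p∣ {X = outside ∷ X} {fsuc x} x∉X = ∣p∪⁅x⁆∣≡1+∣p∣ (drop-not-there x∉X)

x∈dueBy : ∀ {n} (d : Fin n → ℕ) {t x} → d x ≤ t → x ∈ dueBy d t
x∈dueBy d {t} {x} dx≤t = lookup⇒[]= x _ (trans (lookup∘tabulate _ x) (if-true (ℕ.≤⇒≤ᵇ dx≤t)))
  where
  if-true : ∀ {b} → T b → (if b then inside else outside) ≡ inside
  if-true {true} _ = refl

∪-monoˡ-⊆ : ∀ {n} {X Y : Subset n} Z → X ⊆ Y → X ∪ Z ⊆ Y ∪ Z
∪-monoˡ-⊆ {X = X} Z X⊆Y x∈X∪Z with x∈p∪q⁻ X Z x∈X∪Z
... | inj₁ x∈X = x∈p∪q⁺ (inj₁ (X⊆Y x∈X))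
... | inj₂ x∈Z = x∈p∪q⁺ (inj₂ x∈Z)

∈-∪⁅⁆-elim : ∀ {n} {P : Fin n → Set} {X : Subset n} {e}
           → (∀ {x} → x ∈ X → P x) → P e → ∀ {x} → x ∈ X ∪ ⁅ e ⁆ → P x
∈-∪⁅⁆-elim {P = P} {X} {e} PX Pe x∈X∪e with x∈p∪q⁻ X ⁅ e ⁆ x∈X∪e
... | inj₁ x∈X = PX x∈X
... | inj₂ x∈e = subst P (sym (x∈⁅y⁆⇒x≡y e x∈e)) Pe

∉-∪⁅⁆ : ∀ {n} {X : Subset n} {e x} → x ∉ X → e ≢ x → x ∉ X ∪ ⁅ e ⁆
∉-∪⁅⁆ {X = X} {e} x∉X e≢x x∈X∪e with x∈p∪q⁻ X ⁅ e ⁆ x∈X∪e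
... | inj₁ x∈X = x∉X x∈X
... | inj₂ x∈e = e≢x (sym (x∈⁅y⁆⇒x≡y e x∈e))

InL-due-bound : ∀ {n} (d : Fin n → ℕ) {Q B : Subset n} {m} → InL d Q → 1 ≤ m
              → B ⊆ Q → (∀ {x} → x ∈ B → d x ≤ m) → ∣ B ∣ ≤ m
InL-due-bound d {Q} {B} {m} inL 1≤m B⊆Q B-due = begin
  ∣ B ∣               ≤⟨ p⊆q⇒∣p∣≤∣q∣ (λ x∈B → x∈p∩q⁺ (B⊆Q x∈B , x∈dueBy d (B-due x∈B))) ⟩
  ∣ Q ∩ dueBy d m ∣   ≤⟨ inL m 1≤m ⟩
  m                   ∎
  where open ℕ.≤-Reasoning

module Charging {n : ℕ} (p : Fin n → ℚ) (d : Fin n → ℕ) (d≥1 : ∀ e → 1 ≤ d e)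
         (Iin Iout : Subset n → Set) (π : Fin n → Bool) where

  record Invariant (c : ℚ) (s : State n) : Set where
    constructor invariant
    open State s
    field
      B⊆Q     : B ⊆ Q
      B-late  : ∀ {x} → x ∈ B → d x < t
      slack   : ℕ
      t≡      : t ≡ suc (∣ B ∣ ℕ+ slack)
      charged : sumOver p B + sumOver p B + slack · c ≤ℚ sumOver p Q

  invariant-initial : ∀ c → Invariant c initial
  invariant-initial c = record
    { B⊆Q     = ⊆-refl
    ; B-late  = λ x∈⊥ → ⊥-elim (∉⊥ x∈⊥)
    ; slack   = 0
    ; t≡      = cong suc (sym (trans (ℕ.+-identityʳ _) (∣⊥∣≡0 n)))
    ; charged = subst₂ _≤ℚ_ (sym (cong (λ x → x + x + 0ℚ) (sumOver-⊥ p))) (sym (sumOver-⊥ p)) ℚ.≤-refl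
    }

  invariant-weaken : ∀ {c c′ s} → c′ ≤ℚ c → Invariant c s → Invariant c′ s
  invariant-weaken {s = s} c′≤c (invariant B⊆Q B-late j t≡ charged) =
    invariant B⊆Q B-late j t≡ (ℚ.≤-trans (ℚ.+-monoʳ-≤ (pB + pB) (·-monoʳ-≤ j c′≤c)) charged)
    where pB = sumOver p (State.B s)

  probe-preserves : ∀ {Q S S′ B t e} → e ∉ Q
                  → Invariant (p e) ⟨ Q , S , B , t ⟩ → Invariant (p e) ⟨ Q ∪ ⁅ e ⁆ , S′ , B , suc t ⟩
  probe-preserves {Q} {B = B} {e = e} e∉Q (invariant B⊆Q B-late j t≡ charged) = record
    { B⊆Q     = λ x∈B → p⊆p∪q ⁅ e ⁆ (B⊆Q x∈B)
    ; B-late  = λ x∈B → ℕ.m<n⇒m<1+n (B-late x∈B)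
    ; slack   = suc j
    ; t≡      = cong suc (trans t≡ (sym (ℕ.+-suc ∣ B ∣ j)))
    ; charged = begin
        pB + pB + (p e + j · p e)  ≡⟨ solve 3 (λ b x w → b :+ b :+ (x :+ w) := x :+ (b :+ b :+ w)) refl pB (p e) (j · p e) ⟩
        p e + (pB + pB + j · p e)  ≤⟨ ℚ.+-monoʳ-≤ (p e) charged ⟩
        p e + sumOver p Q          ≡⟨ sumOver-∪⁅⁆ p e∉Q ⟨
        sumOver p (Q ∪ ⁅ e ⁆)      ∎
    }
    where
    open ℚ.≤-Reasoning
    pB = sumOver p B

  late-slack : ∀ {c Q S B t e} → InL d (Q ∪ ⁅ e ⁆) → d e < t → e ∉ Q
             → (inv : Invariant c ⟨ Q , S , B , t ⟩) → suc ∣ B ∣ ≤ ∣ B ∣ ℕ+ Invariant.slack inv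
  late-slack {B = B} {t} {e} inL de<t e∉Q (invariant B⊆Q B-late j t≡ _) =
    subst (_≤ ∣ B ∣ ℕ+ j) (∣p∪⁅x⁆∣≡1+∣p∣ (λ e∈B → e∉Q (B⊆Q e∈B)))
      (InL-due-bound d inL (ℕ.≤-trans (d≥1 e) (due de<t)) (∪-monoˡ-⊆ ⁅ e ⁆ B⊆Q)
        (∈-∪⁅⁆-elim (λ x∈B → due (B-late x∈B)) (due de<t)))
    where
    due : ∀ {x} → d x < t → d x ≤ ∣ B ∣ ℕ+ j
    due dx<t = ℕ.≤-pred (subst (_ <_) t≡ dx<t)

  late-preserves : ∀ {Q S S′ B t e} → InL d (Q ∪ ⁅ e ⁆) → d e < t → e ∉ Q
                 → Invariant (p e) ⟨ Q , S , B , t ⟩ → Invariant (p e) ⟨ Q ∪ ⁅ e ⁆ , S′ , B ∪ ⁅ e ⁆ , t ⟩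
  late-preserves {B = B} inL de<t e∉Q inv@(invariant _ _ zero _ _) =
    ⊥-elim (ℕ.1+n≰n (subst (suc ∣ B ∣ ≤_) (ℕ.+-identityʳ ∣ B ∣) (late-slack inL de<t e∉Q inv)))
  late-preserves {Q} {B = B} {e = e} inL de<t e∉Q (invariant B⊆Q B-late (suc j) t≡ charged) = record
    { B⊆Q     = ∪-monoˡ-⊆ ⁅ e ⁆ B⊆Q
    ; B-late  = ∈-∪⁅⁆-elim B-late de<t
    ; slack   = j
    ; t≡      = trans t≡ (cong suc (trans (ℕ.+-suc ∣ B ∣ j) (cong (_ℕ+ j) (sym (∣p∪⁅x⁆∣≡1+∣p∣ e∉B)))))
    ; charged = begin
        pB′ + pB′ + j · p e                  ≡⟨ cong (λ x → x + x + j · p e) (sumOver-∪⁅⁆ p e∉B) ⟩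
        (p e + pB) + (p e + pB) + j · p e    ≡⟨ solve 3 (λ b x w → (x :+ b) :+ (x :+ b) :+ w := x :+ (b :+ b :+ (x :+ w))) refl pB (p e) (j · p e) ⟩
        p e + (pB + pB + (p e + j · p e))    ≤⟨ ℚ.+-monoʳ-≤ (p e) charged ⟩
        p e + sumOver p Q                    ≡⟨ sumOver-∪⁅⁆ p e∉Q ⟨
        sumOver p (Q ∪ ⁅ e ⁆)                ∎
    }
    where
    open ℚ.≤-Reasoning
    e∉B : e ∉ B
    e∉B e∈B = e∉Q (B⊆Q e∈B)
    pB  = sumOver p B
    pB′ = sumOver p (B ∪ ⁅ e ⁆)

  step-preserves : ∀ {s e s′ c} → Step Iin Iout d π s e s′ → e ∉ State.Q s → p e ≤ℚ c
                 → Invariant c s → Invariant (p e) s′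
  step-preserves (reject _)                        _   pe≤c = invariant-weaken pe≤c
  step-preserves (probe-active _ _ _)              e∉Q pe≤c = probe-preserves e∉Q ∘′ invariant-weaken pe≤c
  step-preserves (probe-inactive _ _ _)            e∉Q pe≤c = probe-preserves e∉Q ∘′ invariant-weaken pe≤c
  step-preserves (late-heads (_ , inL , _) de<t _) e∉Q pe≤c = late-preserves inL de<t e∉Q ∘′ invariant-weaken pe≤c
  step-preserves (late-tails (_ , inL , _) de<t _) e∉Q pe≤c = late-preserves inL de<t e∉Q ∘′ invariant-weaken pe≤c

  step-Q⊆ : ∀ {s e s′} → Step Iin Iout d π s e s′ → State.Q s′ ⊆ State.Q s ∪ ⁅ e ⁆
  step-Q⊆ {e = e} (reject _)     = p⊆p∪q ⁅ e ⁆
  step-Q⊆ (probe-active _ _ _)   = ⊆-refl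
  step-Q⊆ (probe-inactive _ _ _) = ⊆-refl
  step-Q⊆ (late-heads _ _ _)     = ⊆-refl
  step-Q⊆ (late-tails _ _ _)     = ⊆-refl

  step-fresh : ∀ {s e s′ es} → Step Iin Iout d π s e s′
             → All (e ≢_) es → All (_∉ State.Q s) es → All (_∉ State.Q s′) es
  step-fresh st e∉es fresh =
    All.zipWith (λ (e≢x , x∉Q) x∈Q′ → ∉-∪⁅⁆ x∉Q e≢x (step-Q⊆ st x∈Q′)) (e∉es , fresh)

  run-preserves : ∀ {s es f c} → (∀ e → 0ℚ ≤ℚ p e) → Run Iin Iout d π s es f
                → AllPairs _≢_ es → AllPairs (λ a b → p b ≤ℚ p a) es
                → All (_∉ State.Q s) es → All (λ x → p x ≤ℚ c) es
                → 0ℚ ≤ℚ c → Invariant c s → ∃[ c′ ] 0ℚ ≤ℚ c′ × Invariant c′ f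
  run-preserves p≥0 done _ _ _ _ 0≤c inv = _ , 0≤c , inv
  run-preserves {es = e ∷ _} p≥0 (step st run) (e∉es ∷ distinct) (p≤pe ∷ sorted) (e∉Q ∷ fresh) (pe≤c ∷ _) _ inv =
    run-preserves p≥0 run distinct sorted (step-fresh st e∉es fresh) p≤pe (p≥0 e) (step-preserves st e∉Q pe≤c inv)

  invariant⇒bound : ∀ {c s} → 0ℚ ≤ℚ c → Invariant c s
                  → sumOver p (State.Q s) ≤ℚ (1ℚ + 1ℚ) * sumOver p (State.Q s ─ State.B s)
  invariant⇒bound {c} {s} 0≤c (invariant B⊆Q _ j _ charged) = begin
    sumOver p Q      ≡⟨ sumOver-─ p B⊆Q ⟩
    P + pB           ≤⟨ ℚ.+-monoʳ-≤ P pB≤P ⟩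
    P + P            ≡⟨ solve 1 (λ x → x :+ x := (con 1ℚ :+ con 1ℚ) :* x) refl P ⟩
    (1ℚ + 1ℚ) * P    ∎
    where
    open ℚ.≤-Reasoning
    Q  = State.Q s
    B  = State.B s
    P  = sumOver p (Q ─ B)
    pB = sumOver p B
    pB≤P : pB ≤ℚ P
    pB≤P = +-cancelʳ-≤ pB (begin
      pB + pB            ≡⟨ ℚ.+-identityʳ (pB + pB) ⟨
      pB + pB + 0ℚ       ≤⟨ ℚ.+-monoʳ-≤ (pB + pB) (·-nonNeg j 0≤c) ⟩
      pB + pB + j · c    ≤⟨ charged ⟩
      sumOver p Q        ≡⟨ sumOver-─ p B⊆Q ⟩
      P + pB             ∎)

lemma6 : ∀ (n : ℕ) (p : Fin n → ℚ) (d : Fin n → ℕ) (Iin Iout : Subset n → Set)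
    → (∀ e → 0ℚ ≤ℚ p e) → (∀ e → p e ≤ℚ 1ℚ) → (∀ e → 1 ≤ d e)
    → DownwardClosed Iin → DownwardClosed Iout
    → (ord : List (Fin n)) → ord ↭ allFin n
    → AllPairs (λ a b → p b ≤ℚ p a) ord
    → (π : Fin n → Bool) (final : State n)
    → Run Iin Iout d π initial ord final
    → sumOver p (State.Q final) ≤ℚ (1ℚ + 1ℚ) * sumOver p (State.Q final ─ State.B final)
lemma6 n p d Iin Iout p≥0 p≤1 d≥1 _ _ ord ord↭allFin sorted π final run =
  let _ , 0≤c , inv = run-preserves p≥0 run distinct sorted (All.tabulate λ _ → ∉⊥)
                        (All.tabulate λ {x} _ → p≤1 x) (ℚ.nonNegative⁻¹ 1ℚ) (invariant-initial 1ℚ)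
  in invariant⇒bound 0≤c inv
  where
  open Charging p d d≥1 Iin Iout π
  distinct : AllPairs _≢_ ord
  distinct = Unique-resp-↭ (setoid (Fin n)) (↭⇒↭ₛ (↭-sym ord↭allFin)) (allFin⁺ n)
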